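{- Let $p$ be a prime, let $r$ and $n$ be integers with $r/2<n\le r\le p-1$, and let $I=\{0,1,\dots,n,p\}$. Then there exist $\lambda_i\in\mathbb{Z}_p$ ($i\in I$), not all zero, such that $\sum_{i\in I}\lambda_i\, i^j=0$ for all $0\le j\le n$, and such that moreover $\lambda_0\equiv 1\pmod p$, $\lambda_p=-1$, and $\lambda_i\equiv 0\pmod p$ for $1\le i\le n$.
   Context: Here $i^j$ denotes the ordinary integer power (with $0^0=1$), viewed in $\mathbb{Z}_p$. -}

module Defs where

open import Data.Nat as ℕ using (ℕ; zero; suc)
open import Data.Integer as ℤ using (ℤ; +_; -[1+_])
open import Data.Integer.Tactic.RingSolver using (solve-∀)
open import Data.Product using (Σ; ∃; ∃-syntax; _,_; proj₁; proj₂)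
open import Data.List using (List; foldr)
open import Relation.Binary.PropositionalEquality using (_≡_; refl; trans; cong; cong₂; sym)

-- The ring ℤ_p of p-adic integers, realised as the inverse limit of ℤ/p^kℤ:
-- an element is a sequence of integers (x k) that is coherent, i.e.
-- x (k+1) ≡ x k (mod p^k); two such sequences are identified (setoid
-- equality _≈_) when x k ≡ y k (mod p^k) for every k.
module _ (p : ℕ) where

  P : ℕ → ℤ
  P k = + (p ℕ.^ k)

  record ℤp : Set where
    constructor mkℤp
    field
      digit : ℕ → ℤ
      coh   : ∀ k → ∃[ c ] digit (suc k) ≡ digit k ℤ.+ c ℤ.* P k

open ℤp public

module _ {p : ℕ} where

  infix  4 _≈_
  infixl 6 _+p_
  infixl 7 _*p_

  _≈_ : ℤp p → ℤp p → Set
  x ≈ y = ∀ k → ∃[ c ] digit x k ≡ digit y k ℤ.+ c ℤ.* P p k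

  ιℤ : ℤ → ℤp p
  ιℤ a = mkℤp (λ _ → a) (λ k → ℤ.0ℤ , lem a (P p k))
    where
    lem : ∀ a q → a ≡ a ℤ.+ ℤ.0ℤ ℤ.* q
    lem = solve-∀

  _+p_ : ℤp p → ℤp p → ℤp p
  x +p y = mkℤp (λ k → digit x k ℤ.+ digit y k) pf
    where
    pf : ∀ k → ∃[ c ] digit x (suc k) ℤ.+ digit y (suc k)
                      ≡ (digit x k ℤ.+ digit y k) ℤ.+ c ℤ.* P p k
    pf k with coh x k | coh y k
    ... | cx , ex | cy , ey = cx ℤ.+ cy ,
      trans (cong₂ ℤ._+_ ex ey) (lem (digit x k) (digit y k) cx cy (P p k))
      where
      lem : ∀ a b c d q → (a ℤ.+ c ℤ.* q) ℤ.+ (b ℤ.+ d ℤ.* q)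
                        ≡ (a ℤ.+ b) ℤ.+ (c ℤ.+ d) ℤ.* q
      lem = solve-∀

  _*p_ : ℤp p → ℤp p → ℤp p
  x *p y = mkℤp (λ k → digit x k ℤ.* digit y k) pf
    where
    pf : ∀ k → ∃[ c ] digit x (suc k) ℤ.* digit y (suc k)
                      ≡ (digit x k ℤ.* digit y k) ℤ.+ c ℤ.* P p k
    pf k with coh x k | coh y k
    ... | cx , ex | cy , ey =
      cx ℤ.* digit y k ℤ.+ digit x k ℤ.* cy ℤ.+ cx ℤ.* cy ℤ.* P p k ,
      trans (cong₂ ℤ._*_ ex ey) (lem (digit x k) (digit y k) cx cy (P p k))
      where
      lem : ∀ a b c d q → (a ℤ.+ c ℤ.* q) ℤ.* (b ℤ.+ d ℤ.* q)
                        ≡ (a ℤ.* b) ℤ.+ (c ℤ.* b ℤ.+ a ℤ.* d ℤ.+ c ℤ.* d ℤ.* q) ℤ.* q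
      lem = solve-∀

  ιℕ : ℕ → ℤp p
  ιℕ m = ιℤ (+ m)

  0p 1p -1p : ℤp p
  0p  = ιℤ ℤ.0ℤ
  1p  = ιℤ ℤ.1ℤ
  -1p = ιℤ ℤ.-1ℤ

  Σp : {A : Set} → List A → (A → ℤp p) → ℤp p
  Σp xs f = foldr (λ a s → f a +p s) 0p xs

  _≡_[modp] : ℤp p → ℤp p → Set
  x ≡ y [modp] = ∃[ μ ] x ≈ y +p ιℕ p *p μ

-- Newton's forward-difference formula recovers a polynomial f of degree ≤ n from its values at
-- 0, …, n: f x = Σ_{k ≤ n} (x C k) Δᵏf(0) with Δᵏf(0) = Σ_{i ≤ k} (-1)^(k-i) (k C i) f(i), so
-- f x = Σ_{i ≤ n} λᵢ(x) f(i) where λᵢ(x) = Σ_{k ≤ n} (x C k) (-1)^(k-i) (k C i).  Taking f(y) = yʲ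
-- (j ≤ n), x = p and λ_p = -1 gives the linear relations.  Modulo p only the k = 0 term of λᵢ(p)
-- survives, since p divides p C k for 0 < k ≤ n < p; that term is 1 for i = 0 and 0 otherwise.
module Submission where

open import Defs

module Interpolation where

  open import Data.Nat.Base as ℕ using (ℕ; zero; suc; _≤_; _<_; _≤′_; ≤′-refl; ≤′-step; z≤n; s≤s)
  import Data.Nat.Properties as ℕ
  import Data.Nat.Divisibility as ℕ
  open import Data.Nat.Combinatorics using (_C_; nC1≡n; nCk+nC[k+1]≡[n+1]C[k+1])
  open import Data.Nat.Primality using (Prime; euclidsLemma)
  open import Data.Integer.Base using (ℤ; +_; 0ℤ; 1ℤ; -1ℤ; _+_; _*_; _-_; -_)
  open import Data.Integer.Properties
  open import Data.Integer.Divisibility.Signed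
    using (_∣_; divides; ∣ᵤ⇒∣; ∣⇒∣ᵤ; ∣m⇒∣m*n; ∣m∣n⇒∣m+n)
  open import Data.Integer.Tactic.RingSolver using (solve-∀)
  open import Data.List using (_∷_; []; foldr; applyUpTo; upTo; _++_; [_])
  open import Data.List.Properties using (foldr-++)
  open import Data.Product using (_,_)
  open import Data.Sum using (inj₁; inj₂)
  open import Data.Empty using (⊥-elim)
  open import Relation.Nullary using (¬_; yes; no)
  open import Relation.Binary.PropositionalEquality hiding ([_])
  open ≡-Reasoning

  ∑ : ℕ → (ℕ → ℤ) → ℤ
  ∑ zero    g = 0ℤ
  ∑ (suc m) g = g 0 + ∑ m (λ i → g (suc i))

  syntax ∑ m (λ i → e) = ∑[ i < m ] e

  ∑-cong : ∀ m {g h : ℕ → ℤ} → (∀ i → i < m → g i ≡ h i) → ∑ m g ≡ ∑ m h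
  ∑-cong zero    g≡h = refl
  ∑-cong (suc m) g≡h = cong₂ _+_ (g≡h 0 (s≤s z≤n)) (∑-cong m (λ i i<m → g≡h (suc i) (s≤s i<m)))

  ∑-zero : ∀ m → ∑[ i < m ] 0ℤ ≡ 0ℤ
  ∑-zero zero    = refl
  ∑-zero (suc m) = trans (+-identityˡ _) (∑-zero m)

  ∑-head : ∀ m (g : ℕ → ℤ) → (∀ i → g (suc i) ≡ 0ℤ) → ∑ (suc m) g ≡ g 0
  ∑-head m g g≡0 = trans (cong (_+_ (g 0)) (trans (∑-cong m (λ i _ → g≡0 i)) (∑-zero m))) (+-identityʳ (g 0))

  ∑-snoc : ∀ m (g : ℕ → ℤ) → ∑ (suc m) g ≡ ∑ m g + g m
  ∑-snoc zero    g = +-comm (g 0) 0ℤ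
  ∑-snoc (suc m) g = trans (cong (_+_ (g 0)) (∑-snoc m _)) (sym (+-assoc (g 0) _ _))

  ∑-distrib-+ : ∀ m (g h : ℕ → ℤ) → ∑[ i < m ] (g i + h i) ≡ ∑ m g + ∑ m h
  ∑-distrib-+ zero    g h = refl
  ∑-distrib-+ (suc m) g h = begin
    g 0 + h 0 + ∑[ i < m ] (g (suc i) + h (suc i))  ≡⟨ cong (_+_ (g 0 + h 0)) (∑-distrib-+ m _ _) ⟩
    g 0 + h 0 + (∑ m _ + ∑ m _)                      ≡⟨ +-interchange (g 0) (h 0) (∑ m _) (∑ m _) ⟩
    g 0 + ∑ m _ + (h 0 + ∑ m _)                      ∎
    where
    +-interchange : ∀ a b c d → a + b + (c + d) ≡ a + c + (b + d)
    +-interchange = solve-∀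

  ∑-distrib-- : ∀ m (g h : ℕ → ℤ) → ∑[ i < m ] (g i - h i) ≡ ∑ m g - ∑ m h
  ∑-distrib-- zero    g h = refl
  ∑-distrib-- (suc m) g h = begin
    g 0 - h 0 + ∑[ i < m ] (g (suc i) - h (suc i))  ≡⟨ cong (_+_ (g 0 - h 0)) (∑-distrib-- m _ _) ⟩
    g 0 - h 0 + (∑ m _ - ∑ m _)                      ≡⟨ -+-interchange (g 0) (h 0) (∑ m _) (∑ m _) ⟩
    g 0 + ∑ m _ - (h 0 + ∑ m _)                      ∎
    where
    -+-interchange : ∀ a b c d → a - b + (c - d) ≡ a + c - (b + d)
    -+-interchange = solve-∀

  *-distribˡ-∑ : ∀ m c (g : ℕ → ℤ) → c * ∑ m g ≡ ∑[ i < m ] (c * g i)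
  *-distribˡ-∑ zero    c g = *-zeroʳ c
  *-distribˡ-∑ (suc m) c g = trans (*-distribˡ-+ c (g 0) _) (cong (_+_ (c * g 0)) (*-distribˡ-∑ m c _))

  *-distribʳ-∑ : ∀ m c (g : ℕ → ℤ) → ∑ m g * c ≡ ∑[ i < m ] (g i * c)
  *-distribʳ-∑ zero    c g = refl
  *-distribʳ-∑ (suc m) c g = trans (*-distribʳ-+ c (g 0) _) (cong (_+_ (g 0 * c)) (*-distribʳ-∑ m c _))

  ∑-comm : ∀ m l (g : ℕ → ℕ → ℤ) → ∑[ a < m ] ∑[ b < l ] g a b ≡ ∑[ b < l ] ∑[ a < m ] g a b
  ∑-comm zero    l g = sym (∑-zero l)
  ∑-comm (suc m) l g = trans (cong (_+_ (∑ l (g 0))) (∑-comm m l _)) (sym (∑-distrib-+ l _ _))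

  ∣-∑ : ∀ {d} m (g : ℕ → ℤ) → (∀ i → i < m → d ∣ g i) → d ∣ ∑ m g
  ∣-∑ zero    g d∣g = divides 0ℤ refl
  ∣-∑ (suc m) g d∣g = ∣m∣n⇒∣m+n (d∣g 0 (s≤s z≤n)) (∣-∑ m _ (λ i i<m → d∣g (suc i) (s≤s i<m)))

  Δ : (ℕ → ℤ) → ℕ → ℤ
  Δ f x = f (suc x) - f x

  Δ^ : ℕ → (ℕ → ℤ) → ℕ → ℤ
  Δ^ zero    f = f
  Δ^ (suc k) f = Δ (Δ^ k f)

  Δ^-cong : ∀ k {f g : ℕ → ℤ} → (∀ x → f x ≡ g x) → ∀ x → Δ^ k f x ≡ Δ^ k g x
  Δ^-cong zero    f≡g x = f≡g x
  Δ^-cong (suc k) f≡g x = cong₂ _-_ (Δ^-cong k f≡g (suc x)) (Δ^-cong k f≡g x)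

  Δ^-shift : ∀ k (f : ℕ → ℤ) x → Δ^ k (λ y → f (suc y)) x ≡ Δ^ k f (suc x)
  Δ^-shift zero    f x = refl
  Δ^-shift (suc k) f x = cong₂ _-_ (Δ^-shift k f (suc x)) (Δ^-shift k f x)

  Δ^-leibniz : ∀ k (g : ℕ → ℤ) x →
    Δ^ (suc k) (λ y → + y * g y) x ≡ + x * Δ^ (suc k) g x + + suc k * Δ^ k g (suc x)
  Δ^-leibniz zero    g x = regroup (+ x) (g (suc x)) (g x)
    where
    regroup : ∀ a u v → (1ℤ + a) * u - a * v ≡ a * (u - v) + 1ℤ * u
    regroup = solve-∀
  Δ^-leibniz (suc k) g x = begin
    Δ^ (suc k) (λ y → + y * g y) (suc x) - Δ^ (suc k) (λ y → + y * g y) x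
      ≡⟨ cong₂ _-_ (Δ^-leibniz k g (suc x)) (Δ^-leibniz k g x) ⟩
    (+ suc x * Δ^ (suc k) g (suc x) + + suc k * Δ^ k g (suc (suc x)))
      - (+ x * Δ^ (suc k) g x + + suc k * Δ^ k g (suc x))
      ≡⟨ regroup (+ x) (+ suc k) (Δ^ (suc k) g x) (Δ^ k g (suc (suc x))) (Δ^ k g (suc x)) ⟩
    + x * Δ^ (suc (suc k)) g x + + suc (suc k) * Δ^ (suc k) g (suc x) ∎
    where
    regroup : ∀ a b v s t → (1ℤ + a) * (s - t) + b * s - (a * v + b * t)
                            ≡ a * ((s - t) - v) + (1ℤ + b) * (s - t)
    regroup = solve-∀

  record HasDegree≤ (d : ℕ) (f : ℕ → ℤ) : Set where
    constructor hasDegree≤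
    field Δ^-vanishes : ∀ x → Δ^ (suc d) f x ≡ 0ℤ

  open HasDegree≤

  HasDegree≤-mono : ∀ {d e f} → d ≤ e → HasDegree≤ d f → HasDegree≤ e f
  HasDegree≤-mono d≤e = go (ℕ.≤⇒≤′ d≤e)
    where
    go : ∀ {d e f} → d ≤′ e → HasDegree≤ d f → HasDegree≤ e f
    go ≤′-refl        deg = deg
    go (≤′-step d≤′e) deg = hasDegree≤ λ x →
      cong₂ _-_ (Δ^-vanishes (go d≤′e deg) (suc x)) (Δ^-vanishes (go d≤′e deg) x)

  HasDegree≤-shift : ∀ {d f} → HasDegree≤ d f → HasDegree≤ d (λ y → f (suc y))
  HasDegree≤-shift {d} {f} deg = hasDegree≤ λ x → trans (Δ^-shift (suc d) f x) (Δ^-vanishes deg (suc x))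

  HasDegree≤-id* : ∀ {d g} → HasDegree≤ d g → HasDegree≤ (suc d) (λ y → + y * g y)
  HasDegree≤-id* {d} {g} deg = hasDegree≤ λ x → begin
    Δ^ (suc (suc d)) (λ y → + y * g y) x
      ≡⟨ Δ^-leibniz (suc d) g x ⟩
    + x * Δ^ (suc (suc d)) g x + + suc (suc d) * Δ^ (suc d) g (suc x)
      ≡⟨ cong₂ (λ a b → + x * a + + suc (suc d) * b)
               (Δ^-vanishes (HasDegree≤-mono (ℕ.n≤1+n d) deg) x) (Δ^-vanishes deg (suc x)) ⟩
    + x * 0ℤ + + suc (suc d) * 0ℤ
      ≡⟨ cong₂ _+_ (*-zeroʳ (+ x)) (*-zeroʳ (+ suc (suc d))) ⟩
    0ℤ ∎

  HasDegree≤-pow : ∀ j → HasDegree≤ j (λ y → + (y ℕ.^ j))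
  HasDegree≤-pow zero    = hasDegree≤ λ _ → refl
  HasDegree≤-pow (suc j) = hasDegree≤ λ x →
    trans (Δ^-cong (suc (suc j)) (λ y → pos-* y (y ℕ.^ j)) x)
          (Δ^-vanishes (HasDegree≤-id* (HasDegree≤-pow j)) x)

  ∑-pascal : ∀ m x (a : ℕ → ℤ) →
    ∑[ k < suc m ] (+ (suc x C k) * a k)
      ≡ ∑[ k < suc m ] (+ (x C k) * a k) + ∑[ k < m ] (+ (x C k) * a (suc k))
  ∑-pascal m x a = begin
    1ℤ * a 0 + ∑[ k < m ] (+ (suc x C suc k) * a (suc k))
      ≡⟨ cong (_+_ (1ℤ * a 0)) (∑-cong m (λ k _ → pascal k)) ⟩
    1ℤ * a 0 + ∑[ k < m ] (+ (x C k) * a (suc k) + + (x C suc k) * a (suc k))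
      ≡⟨ cong (_+_ (1ℤ * a 0)) (∑-distrib-+ m (λ k → + (x C k) * a (suc k))
                                                (λ k → + (x C suc k) * a (suc k))) ⟩
    1ℤ * a 0 + (L + R)
      ≡⟨ regroup (1ℤ * a 0) L R ⟩
    1ℤ * a 0 + R + L ∎
    where
    L = ∑[ k < m ] (+ (x C k) * a (suc k))
    R = ∑[ k < m ] (+ (x C suc k) * a (suc k))
    pascal : ∀ k → + (suc x C suc k) * a (suc k) ≡ + (x C k) * a (suc k) + + (x C suc k) * a (suc k)
    pascal k = begin
      + (suc x C suc k) * a (suc k)           ≡⟨ cong (λ c → + c * a (suc k)) (nCk+nC[k+1]≡[n+1]C[k+1] x k) ⟨
      + (x C k ℕ.+ x C suc k) * a (suc k)     ≡⟨ cong (_* a (suc k)) (pos-+ (x C k) (x C suc k)) ⟩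
      (+ (x C k) + + (x C suc k)) * a (suc k) ≡⟨ *-distribʳ-+ (a (suc k)) (+ (x C k)) (+ (x C suc k)) ⟩
      + (x C k) * a (suc k) + + (x C suc k) * a (suc k) ∎
    regroup : ∀ a b c → a + (b + c) ≡ a + c + b
    regroup = solve-∀

  newton-forward : ∀ {d f} → HasDegree≤ d f → ∀ x → f x ≡ ∑[ k < suc d ] (+ (x C k) * Δ^ k f 0)
  newton-forward {d} {f} deg zero =
    sym (trans (∑-head d (λ k → + (0 C k) * Δ^ k f 0) (λ _ → refl)) (*-identityˡ (f 0)))
  newton-forward {d} {f} deg (suc x) = begin
    f (suc x)
      ≡⟨ newton-forward (HasDegree≤-shift deg) x ⟩
    ∑[ k < suc d ] (+ (x C k) * Δ^ k (λ y → f (suc y)) 0)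
      ≡⟨ ∑-cong (suc d) (λ k _ → trans (cong (+ (x C k) *_) (Δ^-shift-0 k))
                                        (*-distribˡ-+ (+ (x C k)) (Δ^ k f 0) (Δ^ (suc k) f 0))) ⟩
    ∑[ k < suc d ] (+ (x C k) * Δ^ k f 0 + + (x C k) * Δ^ (suc k) f 0)
      ≡⟨ ∑-distrib-+ (suc d) (λ k → + (x C k) * Δ^ k f 0) (λ k → + (x C k) * Δ^ (suc k) f 0) ⟩
    S₀ + ∑[ k < suc d ] (+ (x C k) * Δ^ (suc k) f 0)
      ≡⟨ cong (_+_ S₀) (∑-snoc d _) ⟩
    S₀ + (S₁ + + (x C d) * Δ^ (suc d) f 0)
      ≡⟨ cong (λ t → S₀ + (S₁ + + (x C d) * t)) (Δ^-vanishes deg 0) ⟩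
    S₀ + (S₁ + + (x C d) * 0ℤ)
      ≡⟨ cong (_+_ S₀) (trans (cong (_+_ S₁) (*-zeroʳ (+ (x C d)))) (+-identityʳ S₁)) ⟩
    S₀ + S₁
      ≡⟨ ∑-pascal d x (λ k → Δ^ k f 0) ⟨
    ∑[ k < suc d ] (+ (suc x C k) * Δ^ k f 0) ∎
    where
    S₀ = ∑[ k < suc d ] (+ (x C k) * Δ^ k f 0)
    S₁ = ∑[ k < d ] (+ (x C k) * Δ^ (suc k) f 0)
    Δ^-shift-0 : ∀ k → Δ^ k (λ y → f (suc y)) 0 ≡ Δ^ k f 0 + Δ^ (suc k) f 0
    Δ^-shift-0 k = trans (Δ^-shift k f 0) (u≡v+[u-v] (Δ^ k f 1) (Δ^ k f 0))
      where
      u≡v+[u-v] : ∀ u v → u ≡ v + (u - v)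
      u≡v+[u-v] = solve-∀

  -- Δcoeff k i = (-1)^(k-i) · (k C i)
  Δcoeff : ℕ → ℕ → ℤ
  Δcoeff zero    zero    = 1ℤ
  Δcoeff zero    (suc i) = 0ℤ
  Δcoeff (suc k) zero    = - Δcoeff k 0
  Δcoeff (suc k) (suc i) = Δcoeff k i - Δcoeff k (suc i)

  Δcoeff-vanish : ∀ {k i} → k < i → Δcoeff k i ≡ 0ℤ
  Δcoeff-vanish {zero}  {suc i} _         = refl
  Δcoeff-vanish {suc k} {suc i} (s≤s k<i) = cong₂ _-_ (Δcoeff-vanish k<i) (Δcoeff-vanish (ℕ.m<n⇒m<1+n k<i))

  Δ^-expansion : ∀ {k N} → k ≤ N → (f : ℕ → ℤ) → Δ^ k f 0 ≡ ∑[ i < suc N ] (Δcoeff k i * f i)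
  Δ^-expansion {zero}  {N} _   f =
    sym (trans (∑-head N (λ i → Δcoeff 0 i * f i) (λ _ → refl)) (*-identityˡ (f 0)))
  Δ^-expansion {suc k} {N} k<N f = begin
    Δ^ k f 1 - Δ^ k f 0
      ≡⟨ cong (_- Δ^ k f 0) (Δ^-shift k f 0) ⟨
    Δ^ k (λ i → f (suc i)) 0 - Δ^ k f 0
      ≡⟨ cong₂ _-_ (Δ^-expansion k≤N (λ i → f (suc i))) (Δ^-expansion k≤N f) ⟩
    ∑[ i < suc N ] (Δcoeff k i * f (suc i)) - (Δcoeff k 0 * f 0 + B)
      ≡⟨ cong (_- (Δcoeff k 0 * f 0 + B)) (∑-snoc N (λ i → Δcoeff k i * f (suc i))) ⟩
    A + Δcoeff k N * f (suc N) - (Δcoeff k 0 * f 0 + B)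
      ≡⟨ cong (λ c → A + c * f (suc N) - (Δcoeff k 0 * f 0 + B)) (Δcoeff-vanish k<N) ⟩
    A + 0ℤ - (Δcoeff k 0 * f 0 + B)
      ≡⟨ regroup A (Δcoeff k 0) (f 0) B ⟩
    - Δcoeff k 0 * f 0 + (A - B)
      ≡⟨ cong (_+_ (- Δcoeff k 0 * f 0)) (∑-distrib-- N (λ i → Δcoeff k i * f (suc i))
                                                        (λ i → Δcoeff k (suc i) * f (suc i))) ⟨
    - Δcoeff k 0 * f 0 + ∑[ i < N ] (Δcoeff k i * f (suc i) - Δcoeff k (suc i) * f (suc i))
      ≡⟨ cong (_+_ (- Δcoeff k 0 * f 0))
              (∑-cong N (λ i _ → *-distribʳ-- (Δcoeff k i) (Δcoeff k (suc i)) (f (suc i)))) ⟩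
    - Δcoeff k 0 * f 0 + ∑[ i < N ] ((Δcoeff k i - Δcoeff k (suc i)) * f (suc i)) ∎
    where
    k≤N = ℕ.<⇒≤ k<N
    A = ∑[ i < N ] (Δcoeff k i * f (suc i))
    B = ∑[ i < N ] (Δcoeff k (suc i) * f (suc i))
    regroup : ∀ a c u b → a + 0ℤ - (c * u + b) ≡ - c * u + (a - b)
    regroup = solve-∀
    *-distribʳ-- : ∀ a b c → a * c - b * c ≡ (a - b) * c
    *-distribʳ-- = solve-∀

  lagrangeCoeff : ℕ → ℕ → ℕ → ℤ
  lagrangeCoeff n x i = ∑[ k < suc n ] (+ (x C k) * Δcoeff k i)

  lagrange-interpolation : ∀ {n f} → HasDegree≤ n f → ∀ x → f x ≡ ∑[ i < suc n ] (lagrangeCoeff n x i * f i)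
  lagrange-interpolation {n} {f} deg x = begin
    f x
      ≡⟨ newton-forward deg x ⟩
    ∑[ k < suc n ] (+ (x C k) * Δ^ k f 0)
      ≡⟨ ∑-cong (suc n) (λ k k<1+n → cong (+ (x C k) *_) (Δ^-expansion (ℕ.≤-pred k<1+n) f)) ⟩
    ∑[ k < suc n ] (+ (x C k) * ∑[ i < suc n ] (Δcoeff k i * f i))
      ≡⟨ ∑-cong (suc n) (λ k _ → trans (*-distribˡ-∑ (suc n) (+ (x C k)) (λ i → Δcoeff k i * f i))
                                        (∑-cong (suc n) (λ i _ → sym (*-assoc (+ (x C k)) (Δcoeff k i) (f i))))) ⟩
    ∑[ k < suc n ] ∑[ i < suc n ] (+ (x C k) * Δcoeff k i * f i)
      ≡⟨ ∑-comm (suc n) (suc n) (λ k i → + (x C k) * Δcoeff k i * f i) ⟩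
    ∑[ i < suc n ] ∑[ k < suc n ] (+ (x C k) * Δcoeff k i * f i)
      ≡⟨ ∑-cong (suc n) (λ i _ → sym (*-distribʳ-∑ (suc n) (f i) (λ k → + (x C k) * Δcoeff k i))) ⟩
    ∑[ i < suc n ] (lagrangeCoeff n x i * f i) ∎

  C-absorption : ∀ n k → suc k ℕ.* (suc n C suc k) ≡ suc n ℕ.* (n C k)
  C-absorption n       zero    = trans (ℕ.*-identityˡ _) (trans (nC1≡n (suc n)) (sym (ℕ.*-identityʳ (suc n))))
  C-absorption zero    (suc k) = ℕ.*-zeroʳ (suc (suc k))
  C-absorption (suc n) (suc k) = begin
    suc (suc k) ℕ.* (suc (suc n) C suc (suc k))
      ≡⟨ cong (suc (suc k) ℕ.*_) (nCk+nC[k+1]≡[n+1]C[k+1] (suc n) (suc k)) ⟨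
    suc (suc k) ℕ.* (suc n C suc k ℕ.+ suc n C suc (suc k))
      ≡⟨ ℕ.*-distribˡ-+ (suc (suc k)) (suc n C suc k) _ ⟩
    suc n C suc k ℕ.+ suc k ℕ.* (suc n C suc k) ℕ.+ suc (suc k) ℕ.* (suc n C suc (suc k))
      ≡⟨ cong₂ (λ a b → suc n C suc k ℕ.+ a ℕ.+ b) (C-absorption n k) (C-absorption n (suc k)) ⟩
    suc n C suc k ℕ.+ suc n ℕ.* (n C k) ℕ.+ suc n ℕ.* (n C suc k)
      ≡⟨ ℕ.+-assoc (suc n C suc k) _ _ ⟩
    suc n C suc k ℕ.+ (suc n ℕ.* (n C k) ℕ.+ suc n ℕ.* (n C suc k))
      ≡⟨ cong (suc n C suc k ℕ.+_) (ℕ.*-distribˡ-+ (suc n) (n C k) (n C suc k)) ⟨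
    suc n C suc k ℕ.+ suc n ℕ.* (n C k ℕ.+ n C suc k)
      ≡⟨ cong (λ c → suc n C suc k ℕ.+ suc n ℕ.* c) (nCk+nC[k+1]≡[n+1]C[k+1] n k) ⟩
    suc (suc n) ℕ.* (suc n C suc k) ∎

  p∣pCk : ∀ {p k} → Prime p → 0 < k → k < p → p ℕ.∣ p C k
  p∣pCk {suc p} {suc k} p-prime _ k<p
    with euclidsLemma (suc k) (suc p C suc k) p-prime
           (ℕ.divides (p C k) (trans (C-absorption p k) (ℕ.*-comm (suc p) (p C k))))
  ... | inj₁ p∣k = ⊥-elim (ℕ.<⇒≱ k<p (ℕ.∣⇒≤ p∣k))
  ... | inj₂ p∣C = p∣C

  lagrangeCoeff-mod : ∀ {p n} → Prime p → n < p → ∀ i → + p ∣ lagrangeCoeff n p i - Δcoeff 0 i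
  lagrangeCoeff-mod {p} {n} p-prime n<p i =
    subst (+ p ∣_) (sym (head-cancels (Δcoeff 0 i) (∑ n tail))) (∣-∑ n tail p∣tail)
    where
    tail : ℕ → ℤ
    tail k = + (p C suc k) * Δcoeff (suc k) i
    p∣tail : ∀ k → k < n → + p ∣ tail k
    p∣tail k k<n = ∣m⇒∣m*n (Δcoeff (suc k) i)
      (∣ᵤ⇒∣ {+ p} {+ (p C suc k)} (p∣pCk p-prime (s≤s z≤n) (ℕ.<-≤-trans (s≤s k<n) n<p)))
    head-cancels : ∀ a r → 1ℤ * a + r - a ≡ r
    head-cancels = solve-∀

  digit-Σp : ∀ {p} xs (f : ℕ → ℤp p) k → digit (Σp xs f) k ≡ foldr (λ i s → digit (f i) k + s) 0ℤ xs
  digit-Σp []       f k = refl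
  digit-Σp (x ∷ xs) f k = cong (_+_ (digit (f x) k)) (digit-Σp xs f k)

  foldr-applyUpTo : ∀ m h (g : ℕ → ℤ) z → foldr (λ i s → g i + s) z (applyUpTo h m) ≡ ∑[ i < m ] g (h i) + z
  foldr-applyUpTo zero    h g z = sym (+-identityˡ z)
  foldr-applyUpTo (suc m) h g z =
    trans (cong (_+_ (g (h 0))) (foldr-applyUpTo m (λ i → h (suc i)) g z)) (sym (+-assoc (g (h 0)) _ z))

  digit-Σp-upTo-++ : ∀ {p} m x (f : ℕ → ℤp p) k →
    digit (Σp (upTo m ++ [ x ]) f) k ≡ ∑[ i < m ] digit (f i) k + digit (f x) k
  digit-Σp-upTo-++ m x f k = begin
    digit (Σp (upTo m ++ [ x ]) f) k                ≡⟨ digit-Σp (upTo m ++ [ x ]) f k ⟩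
    foldr step 0ℤ (upTo m ++ [ x ])                 ≡⟨ foldr-++ step 0ℤ (upTo m) [ x ] ⟩
    foldr step (digit (f x) k + 0ℤ) (upTo m)        ≡⟨ foldr-applyUpTo m (λ i → i) (λ i → digit (f i) k) _ ⟩
    ∑[ i < m ] digit (f i) k + (digit (f x) k + 0ℤ) ≡⟨ cong (_+_ (∑[ i < m ] digit (f i) k)) (+-identityʳ _) ⟩
    ∑[ i < m ] digit (f i) k + digit (f x) k        ∎
    where
    step : ℕ → ℤ → ℤ
    step i s = digit (f i) k + s

  ιℤ-≡[modp] : ∀ {p} a b → + p ∣ a - b → ιℤ {p} a ≡ ιℤ b [modp]
  ιℤ-≡[modp] {p} a b (divides q a-b≡q*p) = ιℤ q , λ _ → 0ℤ , trans a≡b+p*q (sym (+-identityʳ _))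
    where
    a≡b+p*q : a ≡ b + + p * q
    a≡b+p*q = begin
      a            ≡⟨ u≡v+[u-v] a b ⟩
      b + (a - b)  ≡⟨ cong (_+_ b) a-b≡q*p ⟩
      b + q * + p  ≡⟨ cong (_+_ b) (*-comm q (+ p)) ⟩
      b + + p * q  ∎
      where
      u≡v+[u-v] : ∀ u v → u ≡ v + (u - v)
      u≡v+[u-v] = solve-∀

  ιℤ-≈0p⇒∣ : ∀ {p a} → ιℤ {p} a ≈ 0p → + p ∣ a
  ιℤ-≈0p⇒∣ {p} {a} a≈0 with a≈0 1
  ... | c , a≡0+c*p¹ =
    divides c (trans a≡0+c*p¹ (trans (+-identityˡ _) (cong (λ q → c * + q) (ℕ.^-identityʳ p))))

  coefficient : ℕ → ℕ → ℕ → ℤ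
  coefficient p n i with i ℕ.≟ p
  ... | yes _ = -1ℤ
  ... | no  _ = lagrangeCoeff n p i

  coefficient-at-p : ∀ p n → coefficient p n p ≡ -1ℤ
  coefficient-at-p p n with p ℕ.≟ p
  ... | yes _   = refl
  ... | no  p≢p = ⊥-elim (p≢p refl)

  coefficient-below-p : ∀ {p n i} → i < p → coefficient p n i ≡ lagrangeCoeff n p i
  coefficient-below-p {p} {n} {i} i<p with i ℕ.≟ p
  ... | yes refl = ⊥-elim (ℕ.<-irrefl refl i<p)
  ... | no  _    = refl

  coefficient-moments : ∀ {p n j} → n < p → j ≤ n →
    ∑[ i < suc n ] (coefficient p n i * + (i ℕ.^ j)) + coefficient p n p * + (p ℕ.^ j) ≡ 0ℤ
  coefficient-moments {p} {n} {j} n<p j≤n = begin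
    ∑[ i < suc n ] (coefficient p n i * + (i ℕ.^ j)) + coefficient p n p * + (p ℕ.^ j)
      ≡⟨ cong₂ (λ s c → s + c * + (p ℕ.^ j)) (∑-cong (suc n) below-p) (coefficient-at-p p n) ⟩
    ∑[ i < suc n ] (lagrangeCoeff n p i * + (i ℕ.^ j)) + -1ℤ * + (p ℕ.^ j)
      ≡⟨ cong (_+ -1ℤ * + (p ℕ.^ j)) (lagrange-interpolation (HasDegree≤-mono j≤n (HasDegree≤-pow j)) p) ⟨
    + (p ℕ.^ j) + -1ℤ * + (p ℕ.^ j)
      ≡⟨ a+-1*a≡0 (+ (p ℕ.^ j)) ⟩
    0ℤ ∎
    where
    below-p : ∀ i → i < suc n → coefficient p n i * + (i ℕ.^ j) ≡ lagrangeCoeff n p i * + (i ℕ.^ j)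
    below-p i i≤n = cong (_* + (i ℕ.^ j)) (coefficient-below-p (ℕ.≤-<-trans (ℕ.≤-pred i≤n) n<p))
    a+-1*a≡0 : ∀ a → a + -1ℤ * a ≡ 0ℤ
    a+-1*a≡0 = solve-∀

  coefficient-≡[modp] : ∀ {p n i} → Prime p → n < p → i ≤ n →
    ιℤ {p} (coefficient p n i) ≡ ιℤ (Δcoeff 0 i) [modp]
  coefficient-≡[modp] {p} {n} {i} p-prime n<p i≤n = ιℤ-≡[modp] (coefficient p n i) (Δcoeff 0 i)
    (subst (λ c → + p ∣ c - Δcoeff 0 i) (sym (coefficient-below-p (ℕ.≤-<-trans i≤n n<p)))
      (lagrangeCoeff-mod p-prime n<p i))

  coefficient-at-p-≈-1p : ∀ {p n} → ιℤ {p} (coefficient p n p) ≈ -1p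
  coefficient-at-p-≈-1p {p} {n} _ = 0ℤ , coefficient-at-p p n

  coefficient-at-p-≉0p : ∀ {p n} → 1 < p → ¬ (ιℤ {p} (coefficient p n p) ≈ 0p)
  coefficient-at-p-≉0p {p} {n} 1<p λₚ≈0 = ℕ.<⇒≢ 1<p (sym (ℕ.∣1⇒≡1 (∣⇒∣ᵤ p∣-1)))
    where
    p∣-1 : + p ∣ -1ℤ
    p∣-1 = subst (+ p ∣_) (coefficient-at-p p n) (ιℤ-≈0p⇒∣ λₚ≈0)

  moments-vanish : ∀ {p n j} → n < p → j ≤ n →
    Σp (upTo (n ℕ.+ 1) ++ [ p ]) (λ i → ιℤ (coefficient p n i) *p ιℕ (i ℕ.^ j)) ≈ 0p
  moments-vanish {p} {n} {j} n<p j≤n k = 0ℤ , (begin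
    digit (Σp (upTo (n ℕ.+ 1) ++ [ p ]) f) k
      ≡⟨ digit-Σp-upTo-++ (n ℕ.+ 1) p f k ⟩
    ∑ (n ℕ.+ 1) g + coefficient p n p * + (p ℕ.^ j)
      ≡⟨ cong (λ m → ∑ m g + coefficient p n p * + (p ℕ.^ j)) (ℕ.+-comm n 1) ⟩
    ∑ (suc n) g + coefficient p n p * + (p ℕ.^ j)
      ≡⟨ coefficient-moments n<p j≤n ⟩
    0ℤ ∎)
    where
    f : ℕ → ℤp p
    f i = ιℤ (coefficient p n i) *p ιℕ (i ℕ.^ j)
    g : ℕ → ℤ
    g i = coefficient p n i * + (i ℕ.^ j)

open import Data.Nat using (ℕ; suc; z≤n; _+_; _*_; _∸_; _^_; _≤_; _<_; nonTrivial⇒n>1)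
open import Data.Nat.Properties using (≤-trans; m≤pred[n]⇒suc[m]≤n)
open import Data.Nat.Primality using (Prime; prime⇒nonTrivial; prime⇒nonZero)
open import Data.List using (List; upTo; _++_; [_])
open import Data.List.Membership.Propositional using (_∈_)
open import Data.List.Membership.Propositional.Properties using (∈-++⁺ʳ)
open import Data.List.Relation.Unary.Any using (here)
open import Data.Product using (Σ; ∃; ∃-syntax; _×_; _,_)
open import Relation.Nullary using (¬_)
open import Relation.Binary.PropositionalEquality using (refl)
open Interpolation

mainTheorem3 : (p r n : ℕ) → Prime p → r < 2 * n → n ≤ r → r ≤ p ∸ 1 →
    let I : List ℕ
        I = upTo (n + 1) ++ [ p ]
    in Σ (ℕ → ℤp p) λ λ' → ((∃[ i ] (i ∈ I × ¬ (λ' i ≈ 0p)))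
      × (∀ j → j ≤ n → Σp I (λ i → λ' i *p ιℕ (i ^ j)) ≈ 0p)
      × (λ' 0 ≡ 1p [modp])
      × (λ' p ≈ -1p)
      × (∀ i → 1 ≤ i → i ≤ n → λ' i ≡ 0p [modp]))
mainTheorem3 p r n p-prime _ n≤r r≤p∸1 =
  λ' , (p , ∈-++⁺ʳ (upTo (n + 1)) (here refl) , coefficient-at-p-≉0p 1<p)
     , (λ j j≤n → moments-vanish n<p j≤n)
     , coefficient-≡[modp] p-prime n<p z≤n
     , coefficient-at-p-≈-1p
     , λ { (suc i) _ 1+i≤n → coefficient-≡[modp] p-prime n<p 1+i≤n }
  where
  λ' : ℕ → ℤp p
  λ' i = ιℤ (coefficient p n i)
  1<p : 1 < p
  1<p = nonTrivial⇒n>1 p {{prime⇒nonTrivial p-prime}}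
  n<p : n < p
  n<p = m≤pred[n]⇒suc[m]≤n {{prime⇒nonZero p-prime}} (≤-trans n≤r r≤p∸1)
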